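{- Let $\mathcal G$ be the class of all finite triangle-free complete labeled graphs and $\sigma\mathcal G$ the class of all countable triangle-free complete labeled graphs. No countably infinite triangle-free complete labeled graph $X$ is an amalgamation base in $\sigma\mathcal G$.
   Context: A triangle-free complete labeled graph is a set $X$ together with a coloring $c:[X]^2\to\mathbb N$ of all two-element subsets (edges) such that there are no three distinct points $x,y,z$ with $c(\{x,y\})=c(\{y,z\})=c(\{x,z\})$. Embeddings are injective color-preserving maps. $X\in\sigma\mathcal G$ is an amalgamation base in $\sigma\mathcal G$ if for all embeddings $f:X\to Y$, $g:X\to Z$ with $Y,Z\in\sigma\mathcal G$ there exist $W\in\sigma\mathcal G$ and embeddings $f':Y\to W$, $g':Z\to W$ with $f'\circ f=g'\circ g$. -}

module Defs where

open import Data.Nat using (ℕ)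
open import Data.Product using (Σ; _×_)
open import Relation.Binary.PropositionalEquality using (_≡_; _≢_)
open import Relation.Nullary using (¬_)
open import Function.Definitions using (Injective)
open import Function.Bundles using (_↔_)

-- The coloring is given as a
-- symmetric function col : X → X → ℕ; only its values at distinct pairs
-- x ≢ y are meaningful (values on the diagonal are irrelevant and never used).
record TFGraph : Set₁ where
  field
    Carrier : Set
    col : Carrier → Carrier → ℕ
    col-sym : ∀ x y → col x y ≡ col y x
    triangle-free : ∀ x y z → x ≢ y → y ≢ z → x ≢ z →
                    ¬ (col x y ≡ col y z × col y z ≡ col x z)

open TFGraph public

Countable : TFGraph → Set
Countable X = Σ (Carrier X → ℕ) (λ f → Injective _≡_ _≡_ f)

CountablyInfinite : TFGraph → Set
CountablyInfinite X = Carrier X ↔ ℕ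

record Embedding (X Y : TFGraph) : Set where
  field
    map : Carrier X → Carrier Y
    injective : Injective _≡_ _≡_ map
    preserves : ∀ x x' → x ≢ x' → col Y (map x) (map x') ≡ col X x x'

open Embedding public

AmalgamationBaseσG : TFGraph → Set₁
AmalgamationBaseσG X =
  ∀ (Y Z : TFGraph) → Countable Y → Countable Z →
  (f : Embedding X Y) (g : Embedding X Z) →
  Σ TFGraph (λ W → Countable W ×
    Σ (Embedding Y W) (λ f' → Σ (Embedding Z W) (λ g' →
      ∀ x → map f' (map f x) ≡ map g' (map g x))))

module Submission where

-- Enumerate X as x₀, x₁, … and fix an enumeration θ of the colours ℕ. Extend X by a
-- vertex y with c(y, x₀) = θ 0 and by a vertex z with c(z, x₀) = θ 1, both joined to
-- x_{n+1} by colour θ n; with θ 0, θ 1 chosen away from c(x₀, x₁), c(x₀, x₂) both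
-- extensions are triangle-free and countable. In an amalgam, y ≠ z since they see
-- x₀ in different colours; but the colour k of yz is θ n for some n, so y, z, x_{n+1}
-- form a monochromatic triangle.

open import Defs
open import Data.Empty using (⊥)
open import Data.Maybe using (Maybe; just; nothing)
open import Data.Nat using (ℕ; zero; suc; _<_; _≤_; z≤n; s≤s; _<?_; _≟_)
open import Data.Nat.Properties
open import Data.Product using (_×_; _,_; proj₁; proj₂; ∃-syntax)
open import Data.Sum using (_⊎_; inj₁; inj₂)
open import Function using (_∘_)
open import Function.Bundles using (Inverse)
open import Function.Definitions using (Injective)
open import Relation.Binary.PropositionalEquality
open import Relation.Nullary using (¬_; yes; no; contradiction)
open import Relation.Binary.Definitions using (tri<; tri≈; tri>)

punch : ℕ → ℕ → ℕ
punch s n with n <? s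
... | yes _ = n
... | no _ = suc n

punch-cases : ∀ s n → (n < s × punch s n ≡ n) ⊎ (s ≤ n × punch s n ≡ suc n)
punch-cases s n with n <? s
... | yes n<s = inj₁ (n<s , refl)
... | no n≮s = inj₂ (≮⇒≥ n≮s , refl)

punch-≢ : ∀ s n → punch s n ≢ s
punch-≢ s n with punch-cases s n
... | inj₁ (n<s , eq) = <⇒≢ (subst (_< s) (sym eq) n<s)
... | inj₂ (s≤n , eq) = >⇒≢ (subst (s <_) (sym eq) (s≤s s≤n))

n≤punch : ∀ s n → n ≤ punch s n
n≤punch s n with punch-cases s n
... | inj₁ (_ , eq) = ≤-reflexive (sym eq)
... | inj₂ (_ , eq) = ≤-trans (n≤1+n n) (≤-reflexive (sym eq))

punch-injective : ∀ s → Injective _≡_ _≡_ (punch s)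
punch-injective s {m} {n} eq with punch-cases s m | punch-cases s n
... | inj₁ (_ , em) | inj₁ (_ , en) = trans (sym em) (trans eq en)
... | inj₂ (_ , em) | inj₂ (_ , en) = suc-injective (trans (sym em) (trans eq en))
... | inj₁ (m<s , em) | inj₂ (s≤n , en) =
  contradiction (trans (sym em) (trans eq en)) (<⇒≢ (<-≤-trans m<s (m≤n⇒m≤1+n s≤n)))
... | inj₂ (s≤m , em) | inj₁ (n<s , en) =
  contradiction (trans (sym em) (trans eq en)) (>⇒≢ (<-≤-trans n<s (m≤n⇒m≤1+n s≤m)))

punch-< : ∀ {s n} → n < s → punch s n ≡ n
punch-< {s} {n} n<s with punch-cases s n
... | inj₁ (_ , eq) = eq
... | inj₂ (s≤n , _) = contradiction s≤n (<⇒≱ n<s)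

punch-≥ : ∀ {s n} → s ≤ n → punch s n ≡ suc n
punch-≥ {s} {n} s≤n with punch-cases s n
... | inj₁ (n<s , _) = contradiction s≤n (<⇒≱ n<s)
... | inj₂ (_ , eq) = eq

punch-surjective : ∀ s k → k ≢ s → ∃[ n ] punch s n ≡ k
punch-surjective s k k≢s with <-cmp k s
... | tri< k<s _ _ = k , punch-< k<s
... | tri≈ _ k≡s _ = contradiction k≡s k≢s
... | tri> _ _ (s≤s {n = n} s≤n) = n , punch-≥ s≤n

moveFront : ℕ → ℕ → ℕ
moveFront s zero = s
moveFront s (suc n) = punch s n

moveFront-injective : ∀ s → Injective _≡_ _≡_ (moveFront s)
moveFront-injective s {zero} {zero} _ = refl
moveFront-injective s {zero} {suc n} eq = contradiction (sym eq) (punch-≢ s n)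
moveFront-injective s {suc m} {zero} eq = contradiction eq (punch-≢ s m)
moveFront-injective s {suc m} {suc n} eq = cong suc (punch-injective s eq)

moveFront-surjective : ∀ s k → ∃[ n ] moveFront s n ≡ k
moveFront-surjective s k with k ≟ s
... | yes k≡s = zero , sym k≡s
... | no k≢s with punch-surjective s k k≢s
...   | n , eq = suc n , eq

avoiding : ℕ → ℕ → ℕ → ℕ
avoiding a b = moveFront (suc b) ∘ moveFront (suc (suc a))

avoiding-injective : ∀ a b → Injective _≡_ _≡_ (avoiding a b)
avoiding-injective a b = moveFront-injective (suc (suc a)) ∘ moveFront-injective (suc b)

avoiding-surjective : ∀ a b k → ∃[ n ] avoiding a b n ≡ k
avoiding-surjective a b k with moveFront-surjective (suc b) k
... | m , eq with moveFront-surjective (suc (suc a)) m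
...   | n , refl = n , eq

avoiding-0 : ∀ a b → a ≢ avoiding a b 0
avoiding-0 a b = <⇒≢ (n≤punch (suc b) (suc a))

avoiding-1 : ∀ a b → b ≢ avoiding a b 1
avoiding-1 a b eq = <⇒≢ (n<1+n b) (trans eq (cong (moveFront (suc b)) (punch-< {suc (suc a)} (s≤s z≤n))))

Admissible : (X : TFGraph) → (Carrier X → ℕ) → Set
Admissible X φ = ∀ u v → u ≢ v → φ u ≡ φ v → col X u v ≢ φ u

module OnePointExtension (X : TFGraph) (φ : Carrier X → ℕ) (admissible : Admissible X φ) where

  -- nothing is the new vertex
  colour : Maybe (Carrier X) → Maybe (Carrier X) → ℕ
  colour nothing nothing = 0
  colour nothing (just v) = φ v
  colour (just u) nothing = φ u
  colour (just u) (just v) = col X u v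

  colour-sym : ∀ x y → colour x y ≡ colour y x
  colour-sym nothing nothing = refl
  colour-sym nothing (just v) = refl
  colour-sym (just u) nothing = refl
  colour-sym (just u) (just v) = col-sym X u v

  colour-triangle-free : ∀ x y z → x ≢ y → y ≢ z → x ≢ z →
                         ¬ (colour x y ≡ colour y z × colour y z ≡ colour x z)
  colour-triangle-free nothing nothing _ x≢y _ _ _ = x≢y refl
  colour-triangle-free nothing (just _) nothing _ _ x≢z _ = x≢z refl
  colour-triangle-free (just _) nothing nothing _ y≢z _ _ = y≢z refl
  colour-triangle-free nothing (just v) (just w) _ y≢z _ (e₁ , e₂) =
    admissible v w (y≢z ∘ cong just) (trans e₁ e₂) (sym e₁)
  colour-triangle-free (just u) nothing (just w) _ _ x≢z (e₁ , e₂) =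
    admissible u w (x≢z ∘ cong just) e₁ (sym (trans e₁ e₂))
  colour-triangle-free (just u) (just v) nothing x≢y _ _ (e₁ , e₂) =
    admissible u v (x≢y ∘ cong just) (sym e₂) (trans e₁ e₂)
  colour-triangle-free (just u) (just v) (just w) x≢y y≢z x≢z =
    triangle-free X u v w (x≢y ∘ cong just) (y≢z ∘ cong just) (x≢z ∘ cong just)

  extension : TFGraph
  extension = record
    { Carrier = Maybe (Carrier X)
    ; col = colour
    ; col-sym = colour-sym
    ; triangle-free = colour-triangle-free
    }

  extension-countable : Countable X → Countable extension
  extension-countable (code , code-injective) = code′ , λ {x} {y} → code′-injective x y
    where
    code′ : Maybe (Carrier X) → ℕ
    code′ nothing = 0
    code′ (just u) = suc (code u)
    code′-injective : ∀ x y → code′ x ≡ code′ y → x ≡ y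
    code′-injective nothing nothing _ = refl
    code′-injective (just u) (just v) eq = cong just (code-injective (suc-injective eq))

  inclusion : Embedding X extension
  inclusion = record { map = just ; injective = λ { refl → refl } ; preserves = λ _ _ _ → refl }

  module _ {W : TFGraph} (f : Embedding extension W) where

    new-vertex-≢ : ∀ u → map f nothing ≢ map f (just u)
    new-vertex-≢ u eq with injective f eq
    ... | ()

    new-vertex-colour : ∀ u → col W (map f nothing) (map f (just u)) ≡ φ u
    new-vertex-colour u = preserves f nothing (just u) λ ()

extensions-not-amalgamable :
  (X : TFGraph) (φ ψ : Carrier X → ℕ) (φ-admissible : Admissible X φ) (ψ-admissible : Admissible X ψ) →
  (x₀ : Carrier X) → φ x₀ ≢ ψ x₀ → (∀ k → ∃[ x ] (φ x ≡ k × ψ x ≡ k)) →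
  (W : TFGraph)
  (f : Embedding (OnePointExtension.extension X φ φ-admissible) W)
  (g : Embedding (OnePointExtension.extension X ψ ψ-admissible) W) →
  (∀ x → map f (just x) ≡ map g (just x)) → ⊥
extensions-not-amalgamable X φ ψ φ-admissible ψ-admissible x₀ φx₀≢ψx₀ common W f g square =
  triangle-free W y z w y≢z z≢w y≢w (sym zw≡k , trans zw≡k (sym yw≡k))
  where
  open OnePointExtension
  y z : Carrier W
  y = map f nothing
  z = map g nothing

  edge-to : (x : Carrier X) → col W y (map f (just x)) ≡ φ x × col W z (map f (just x)) ≡ ψ x
  edge-to x = new-vertex-colour X φ φ-admissible f x
            , trans (cong (col W z) (square x)) (new-vertex-colour X ψ ψ-admissible g x)

  y≢z : y ≢ z
  y≢z y≡z = φx₀≢ψx₀ (begin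
    φ x₀                            ≡⟨ sym (proj₁ (edge-to x₀)) ⟩
    col W y (map f (just x₀))       ≡⟨ cong (λ v → col W v (map f (just x₀))) y≡z ⟩
    col W z (map f (just x₀))       ≡⟨ proj₂ (edge-to x₀) ⟩
    ψ x₀                            ∎)
    where open ≡-Reasoning

  k : ℕ
  k = col W y z

  x : Carrier X
  x = proj₁ (common k)

  w : Carrier W
  w = map f (just x)

  y≢w : y ≢ w
  y≢w = new-vertex-≢ X φ φ-admissible f x

  z≢w : z ≢ w
  z≢w z≡w = new-vertex-≢ X ψ ψ-admissible g x (trans z≡w (square x))

  yw≡k : col W y w ≡ k
  yw≡k = trans (proj₁ (edge-to x)) (proj₁ (proj₂ (common k)))

  zw≡k : col W z w ≡ k
  zw≡k = trans (proj₂ (edge-to x)) (proj₂ (proj₂ (common k)))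

_◂_ : ℕ → (ℕ → ℕ) → ℕ → ℕ
(c ◂ θ) zero = c
(c ◂ θ) (suc n) = θ n

module Enumerated (X : TFGraph) (enum : CountablyInfinite X) where
  open Inverse enum renaming (to to index; from to vertex)

  vertex-index : ∀ {u n} → index u ≡ n → u ≡ vertex n
  vertex-index {u} refl = sym (strictlyInverseʳ u)

  index-injective : ∀ {u v} → index u ≡ index v → u ≡ v
  index-injective eq = trans (vertex-index eq) (sym (vertex-index refl))

  col-index : ∀ {u v m n} → index u ≡ m → index v ≡ n → col X u v ≡ col X (vertex m) (vertex n)
  col-index iu iv = cong₂ (col X) (vertex-index iu) (vertex-index iv)

  -- Colouring the new vertex by θ j at x₀ and by θ n at x_{n+1}, the only repeated
  -- colour is θ j, on the edges to x₀ and to x_{j+1}.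
  prepend-admissible : ∀ {θ} → Injective _≡_ _≡_ θ →
    ∀ j → col X (vertex 0) (vertex (suc j)) ≢ θ j → Admissible X ((θ j ◂ θ) ∘ index)
  prepend-admissible {θ} θ-injective j fresh u v u≢v with index u in iu | index v in iv
  ... | zero | zero = λ _ → contradiction (index-injective (trans iu (sym iv))) u≢v
  ... | suc m | suc n = λ θm≡θn →
    contradiction (index-injective (trans iu (trans (cong suc (θ-injective θm≡θn)) (sym iv)))) u≢v
  ... | zero | suc n = λ θj≡θn c →
    fresh (trans (sym (col-index iu (trans iv (cong suc (sym (θ-injective θj≡θn)))))) c)
  ... | suc m | zero = λ θm≡θj c →
    fresh (trans (sym (col-index iv (trans iu (cong suc (θ-injective θm≡θj)))))
                 (trans (col-sym X v u) (trans c θm≡θj)))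

  countable : Countable X
  countable = index , index-injective

  x₀ : Carrier X
  x₀ = vertex 0

  -- θ 0 and θ 1 avoid the colours of x₀x₁ and x₀x₂, as prepend-admissible requires.
  a b : ℕ
  a = col X x₀ (vertex 1)
  b = col X x₀ (vertex 2)

  θ : ℕ → ℕ
  θ = avoiding a b

  θ-injective : Injective _≡_ _≡_ θ
  θ-injective = avoiding-injective a b

  φ ψ : Carrier X → ℕ
  φ = (θ 0 ◂ θ) ∘ index
  ψ = (θ 1 ◂ θ) ∘ index

  φ-admissible : Admissible X φ
  φ-admissible = prepend-admissible θ-injective 0 (avoiding-0 a b)

  ψ-admissible : Admissible X ψ
  ψ-admissible = prepend-admissible θ-injective 1 (avoiding-1 a b)

  φ≢ψ-at-x₀ : φ x₀ ≢ ψ x₀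
  φ≢ψ-at-x₀ eq = contradiction (θ-injective {0} {1} (subst (λ i → (θ 0 ◂ θ) i ≡ (θ 1 ◂ θ) i) (strictlyInverseˡ 0) eq)) λ ()

  common-colours : ∀ k → ∃[ x ] (φ x ≡ k × ψ x ≡ k)
  common-colours k with avoiding-surjective a b k
  ... | n , θn≡k = vertex (suc n) , on-tail (θ 0) , on-tail (θ 1)
    where
    on-tail : ∀ c → (c ◂ θ) (index (vertex (suc n))) ≡ k
    on-tail c = trans (cong (c ◂ θ) (strictlyInverseˡ (suc n))) θn≡k

proposition5p3 : (X : TFGraph) → CountablyInfinite X → ¬ AmalgamationBaseσG X
proposition5p3 X enum amalgamation-base =
  let W , _ , f , g , square = amalgamation-base Y.extension Z.extension
        (Y.extension-countable countable) (Z.extension-countable countable) Y.inclusion Z.inclusion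
  in extensions-not-amalgamable X φ ψ φ-admissible ψ-admissible x₀ φ≢ψ-at-x₀ common-colours W f g square
  where
  open Enumerated X enum
  module Y = OnePointExtension X φ φ-admissible
  module Z = OnePointExtension X ψ ψ-admissible
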